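{- Let $\Gamma$ be a finite subset of $\mathbb{Z}^k$ and let $P_i=\pi_i(\Gamma)$ for $i\in[1,k]$. Then $H((\Gamma_I^x)_\sigma)=0$ for every $I\subseteq[1,k]$, every $x\in\prod_{i\in I}P_i$ and every product ordering $\sigma$ (on the coordinates $[1,k]\setminus I$) if and only if $\Gamma=P_1\times\dots\times P_k$.
   Context: $\pi_i$ is projection onto the $i$-th coordinate. For $I\subseteq[1,k]$ and $x=(x_i)_{i\in I}$, let $M_I^x$ be the set of elements of $\Gamma$ whose $i$-th coordinate equals $x_i$ for every $i\in I$, and let the section $\Gamma_I^x$ be the projection of $M_I^x$ onto the coordinates in $[1,k]\setminus I$ (a subset of $\mathbb{Z}^{k-|I|}$). For a set $\Delta\subseteq\mathbb{Z}^m$, $H(\Delta)=\sup\min(h(X_1),\dots,h(X_m))$ over random vectors with values in $\Delta$, $h$ the Shannon entropy; $H(\Delta)=0$ iff some coordinate is constant on $\Delta$. A product ordering is a product $\sigma_1\times\dots\times\sigma_m$ of total orders on $\mathbb{Z}$, giving the coordinatewise partial order, and $\Delta_\sigma$ is the set of maximal elements of $\Delta$ under it. -}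

module Defs where

open import Data.Nat using (ℕ)
open import Data.Integer using (ℤ)
open import Data.Fin using (Fin)
open import Data.Fin.Subset using (Subset; _∉_) renaming (_∈_ to _∈ₛ_)
open import Data.Vec using (Vec; lookup)
open import Data.List using (List)
open import Data.List.Membership.Propositional using (_∈_)
open import Data.Product using (Σ; ∃; _×_; proj₁)
open import Relation.Binary using (Rel; IsTotalOrder)
open import Relation.Binary.PropositionalEquality using (_≡_)
open import Level using (0ℓ)

Pt : ℕ → Set
Pt k = Vec ℤ k

FinSet : ℕ → Set
FinSet k = List (Pt k)

InProj : ∀ {k} → FinSet k → Fin k → ℤ → Set
InProj Γ i z = ∃ λ v → (v ∈ Γ) × (lookup v i ≡ z)

IsProduct : ∀ {k} → FinSet k → Set
IsProduct {k} Γ = (v : Pt k) →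
  ((v ∈ Γ → (i : Fin k) → InProj Γ i (lookup v i)) ×
   (((i : Fin k) → InProj Γ i (lookup v i)) → v ∈ Γ))

-- x ∈ ∏_{i ∈ I} P_i ; x is a function on Fin k of which only coordinates in I matter
InProdP : ∀ {k} → FinSet k → Subset k → (Fin k → ℤ) → Set
InProdP {k} Γ I x = (i : Fin k) → i ∈ₛ I → InProj Γ i (x i)

InM : ∀ {k} → FinSet k → Subset k → (Fin k → ℤ) → Pt k → Set
InM {k} Γ I x v = (v ∈ Γ) × ((i : Fin k) → i ∈ₛ I → lookup v i ≡ x i)

-- Elements of the section Γ_I^x are the projections of elements of M_I^x onto
-- the coordinates outside I; we work with representatives v ∈ M_I^x and compare
-- them only on coordinates outside I.
AgreeOff : ∀ {k} → Subset k → Pt k → Pt k → Set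
AgreeOff {k} I v w = (j : Fin k) → j ∉ I → lookup v j ≡ lookup w j

-- A product ordering: a total order σ_j on ℤ for each coordinate j
-- (only the coordinates outside I are used).
ProductOrdering : ℕ → Set₁
ProductOrdering k = Σ (Fin k → Rel ℤ 0ℓ) (λ σ → (j : Fin k) → IsTotalOrder _≡_ (σ j))

LeOff : ∀ {k} → ProductOrdering k → Subset k → Pt k → Pt k → Set
LeOff {k} σ I v w = (j : Fin k) → j ∉ I → proj₁ σ j (lookup v j) (lookup w j)

IsMaxSec : ∀ {k} → FinSet k → Subset k → (Fin k → ℤ) → ProductOrdering k → Pt k → Set
IsMaxSec {k} Γ I x σ v =
  InM Γ I x v × ((w : Pt k) → InM Γ I x w → LeOff σ I v w → AgreeOff I v w)

-- H((Γ_I^x)_σ) = 0, via: some coordinate (outside I) is constant on (Γ_I^x)_σ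
HZeroMaxSec : ∀ {k} → FinSet k → Subset k → (Fin k → ℤ) → ProductOrdering k → Set
HZeroMaxSec {k} Γ I x σ = ∃ λ (j : Fin k) → (j ∉ I) ×
  ((v w : Pt k) → IsMaxSec Γ I x σ v → IsMaxSec Γ I x σ w → lookup v j ≡ lookup w j)

ProperSubset : ∀ {k} → Subset k → Set
ProperSubset {k} I = ∃ λ (j : Fin k) → j ∉ I

{-# OPTIONS --safe #-}
-- If Γ = P₁ × … × Pₖ, the free coordinate j of a maximal element v of a section can be
-- replaced by that of any other element w of the section without leaving it, so v_j ≤ w_j
-- forces v_j = w_j by maximality; by totality of σ_j all maximal elements agree at j.
-- Conversely, take y ∈ P₁ × … × Pₖ and order every coordinate so that y_i is on top. Grow a
-- set I of coordinates while the section of Γ through y on I is nonempty and attains y_j at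
-- every free coordinate j. A top value that is attained is attained by a maximal element, so
-- the coordinate j provided by the hypothesis equals y_j on all maximal elements, and these
-- carry the invariant over to I ∪ {j}. Once I = [1,k] the section is {y}, so y ∈ Γ.
module Submission where

open import Defs
open import Data.Bool using (if_then_else_)
open import Data.Fin using (Fin; zero; _≟_)
open import Data.Fin.Properties using (all?; ¬∀⟶∃¬)
open import Data.Fin.Subset using (Subset; ⊥; ⁅_⁆; _∪_; _⊃_; _∉_) renaming (_∈_ to _∈ₛ_)
open import Data.Fin.Subset.Induction using (⊃-wellFounded)
open import Data.Fin.Subset.Properties using (∉⊥; p⊆p∪q; q⊆p∪q; x∈p∪q⁻; x∈⁅x⁆; x∈⁅y⁆⇒x≡y)
  renaming (_∈?_ to _∈ₛ?_)
open import Data.Integer using (ℤ)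
import Data.Integer.Properties as ℤ
open import Data.List using ([]; _∷_)
import Data.List.Membership.DecPropositional as DecMembership
open import Data.List.Membership.Propositional using (_∈_)
open import Data.List.Membership.Propositional.Properties using (∈-filter⁺; ∈-filter⁻)
open import Data.List.Relation.Unary.Any using (here; there)
open import Data.Nat using (ℕ; _≤_; s≤s)
open import Data.Product using (_×_; _,_; proj₁; proj₂; ∃; map₂)
open import Data.Sum using (inj₁; inj₂; [_,_]′)
open import Data.Vec using (lookup; _[_]≔_)
open import Data.Vec.Properties using (lookup∘update; lookup∘update′; ≡-dec)
open import Data.Vec.Relation.Binary.Pointwise.Extensional using (ext; Pointwise-≡⇒≡)
open import Function using (_∘_; _on_)
open import Induction.WellFounded using (Acc; acc)
open import Level using (0ℓ)
open import Relation.Binary using (Rel; IsTotalOrder; Transitive; Decidable)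
open import Relation.Binary.Construct.Add.Supremum.NonStrict (Data.Integer._≤_)
  using (_≤⁺_; _≤⊤⁺; ≤⁺-reflexive-≡; ≤⁺-trans; ≤⁺-antisym-≡; ≤⁺-total; ≤⁺-dec)
open import Relation.Binary.PropositionalEquality
  using (_≡_; refl; sym; trans; subst; isEquivalence)
open import Relation.Nullary using (yes; no; does; ¬?; contradiction)
open import Relation.Nullary.Construct.Add.Supremum using (_⁺; ⊤⁺; [_]; []-injective)
open import Relation.Nullary.Decidable using (_×-dec_; _→-dec_)
import Relation.Unary as U

module _ {ℓ₁ ℓ₂} {A : Set ℓ₁} {_≼_ : Rel A ℓ₂}
         (≼-trans : Transitive _≼_) (_≼?_ : Decidable _≼_) where

  maximal-∷ : ∀ x xs → ∃ λ m → m ∈ x ∷ xs × (∀ {u} → u ∈ x ∷ xs → m ≼ u → u ≼ m)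
  maximal-∷ x [] = x , here refl , λ { (here refl) x≼x → x≼x }
  maximal-∷ x (x′ ∷ xs) with maximal-∷ x′ xs
  ... | m , m∈ , m-max with m ≼? x
  ...   | yes m≼x = x , here refl , x-max
    where
    x-max : ∀ {u} → u ∈ x ∷ x′ ∷ xs → x ≼ u → u ≼ x
    x-max (here refl) x≼x = x≼x
    x-max (there u∈)  x≼u = ≼-trans (m-max u∈ (≼-trans m≼x x≼u)) m≼x
  ...   | no m⋠x = m , there m∈ , λ { (here refl) m≼x → contradiction m≼x m⋠x
                                    ; (there u∈) → m-max u∈ }

  maximal-∈ : ∀ {a xs} → a ∈ xs → ∃ λ m → m ∈ xs × (∀ {u} → u ∈ xs → m ≼ u → u ≼ m)
  maximal-∈ {xs = x ∷ xs} _ = maximal-∷ x xs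

liftTop : ℤ → ℤ → ℤ ⁺
liftTop y a = if does (a ℤ.≟ y) then ⊤⁺ else [ a ]

liftTop-self : ∀ y → liftTop y y ≡ ⊤⁺
liftTop-self y with y ℤ.≟ y
... | yes _   = refl
... | no y≢y = contradiction refl y≢y

liftTop-⊤⁺ : ∀ {y a} → liftTop y a ≡ ⊤⁺ → a ≡ y
liftTop-⊤⁺ {y} {a} eq with a ℤ.≟ y
... | yes a≡y = a≡y

liftTop-injective : ∀ {y a b} → liftTop y a ≡ liftTop y b → a ≡ b
liftTop-injective {y} {a} {b} eq with a ℤ.≟ y | b ℤ.≟ y
... | yes a≡y | yes b≡y = trans a≡y (sym b≡y)
... | no _    | no _    = []-injective eq

TopAt : ℤ → Rel ℤ 0ℓ
TopAt y = _≤⁺_ on liftTop y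

TopAt-isTotalOrder : ∀ y → IsTotalOrder _≡_ (TopAt y)
TopAt-isTotalOrder y = record
  { isPartialOrder = record
    { isPreorder = record
      { isEquivalence = isEquivalence
      ; reflexive     = λ { refl → ≤⁺-reflexive-≡ ℤ.≤-reflexive refl }
      ; trans         = ≤⁺-trans ℤ.≤-trans
      }
    ; antisym = λ a≤b b≤a → liftTop-injective (≤⁺-antisym-≡ ℤ.≤-antisym a≤b b≤a)
    }
  ; total = λ a b → ≤⁺-total ℤ.≤-total (liftTop y a) (liftTop y b)
  }

TopAt-dec : ∀ y → Decidable (TopAt y)
TopAt-dec y a b = ≤⁺-dec ℤ._≤?_ (liftTop y a) (liftTop y b)

TopAt-maximal : ∀ {y b} → TopAt y y b → b ≡ y
TopAt-maximal {y} {b} y≤b = liftTop-⊤⁺ (⊤⁺-maximal (subst (_≤⁺ liftTop y b) (liftTop-self y) y≤b))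
  where
  ⊤⁺-maximal : ∀ {p} → ⊤⁺ ≤⁺ p → p ≡ ⊤⁺
  ⊤⁺-maximal (_ ≤⊤⁺) = refl

topAt : ∀ {k} → Pt k → ProductOrdering k
topAt y = (λ j → TopAt (lookup y j)) , (λ j → TopAt-isTotalOrder (lookup y j))

MaximalSectionsDegenerate : ∀ {k} → FinSet k → Set₁
MaximalSectionsDegenerate {k} Γ = (I : Subset k) → ProperSubset I →
  (x : Fin k → ℤ) → InProdP Γ I x → (σ : ProductOrdering k) → HZeroMaxSec Γ I x σ

module _ {k} {Γ : FinSet k} (Γ-product : IsProduct Γ) where

  []≔-∈-product : ∀ {v w} j → v ∈ Γ → w ∈ Γ → v [ j ]≔ lookup w j ∈ Γ
  []≔-∈-product {v} {w} j v∈Γ w∈Γ = proj₂ (Γ-product _) coordinate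
    where
    coordinate : ∀ i → InProj Γ i (lookup (v [ j ]≔ lookup w j) i)
    coordinate i with i ≟ j
    ... | yes refl = w , w∈Γ , sym (lookup∘update j v _)
    ... | no i≢j  = v , v∈Γ , sym (lookup∘update′ i≢j v _)

  module _ {I : Subset k} {x : Fin k → ℤ} (σ : ProductOrdering k) {j} (j∉I : j ∉ I) where
    open module Ord {i : Fin k} = IsTotalOrder (proj₂ σ i) using (reflexive; total)

    maximal-coordinate-≤⇒≡ : ∀ {v w} → IsMaxSec Γ I x σ v → InM Γ I x w →
                             proj₁ σ j (lookup v j) (lookup w j) → lookup v j ≡ lookup w j
    maximal-coordinate-≤⇒≡ {v} {w} ((v∈Γ , v∈M) , v-max) (w∈Γ , _) vⱼ≤wⱼ =
      trans (v-max u u∈M v≤u j j∉I) (lookup∘update j v _)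
      where
      u = v [ j ]≔ lookup w j
      u∈M : InM Γ I x u
      u∈M = []≔-∈-product j v∈Γ w∈Γ ,
            λ i i∈I → trans (lookup∘update′ (λ { refl → j∉I i∈I }) v _) (v∈M i i∈I)
      v≤u : LeOff σ I v u
      v≤u i _ with i ≟ j
      ... | yes refl = Ord.trans vⱼ≤wⱼ (reflexive (sym (lookup∘update j v _)))
      ... | no i≢j  = reflexive (sym (lookup∘update′ i≢j v _))

    product⇒HZeroMaxSec : HZeroMaxSec Γ I x σ
    product⇒HZeroMaxSec = j , j∉I , λ v w v-max w-max →
      [ maximal-coordinate-≤⇒≡ v-max (proj₁ w-max)
      , sym ∘ maximal-coordinate-≤⇒≡ w-max (proj₁ v-max)
      ]′ (total (lookup v j) (lookup w j))

  product⇒degenerate : MaximalSectionsDegenerate Γ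
  product⇒degenerate I (j , j∉I) x _ σ = product⇒HZeroMaxSec σ j∉I

∪⁅⁆-⊃ : ∀ {n} {p : Subset n} {j} → j ∉ p → (p ∪ ⁅ j ⁆) ⊃ p
∪⁅⁆-⊃ {p = p} {j} j∉p = p⊆p∪q ⁅ j ⁆ , j , q⊆p∪q p ⁅ j ⁆ (x∈⁅x⁆ j) , j∉p

module _ {k} (Γ : FinSet k) where
  open DecMembership (≡-dec {n = k} ℤ._≟_) using (_∈?_)

  InM-∪-⁅⁆ : ∀ {I x s j} → InM Γ I x s → lookup s j ≡ x j → InM Γ (I ∪ ⁅ j ⁆) x s
  InM-∪-⁅⁆ {I} {x} {s} {j} (s∈Γ , s∈M) sⱼ≡xⱼ = s∈Γ , agree
    where
    agree : ∀ i → i ∈ₛ (I ∪ ⁅ j ⁆) → lookup s i ≡ x i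
    agree i i∈ with x∈p∪q⁻ I ⁅ j ⁆ i∈
    ... | inj₁ i∈I = s∈M i i∈I
    ... | inj₂ i∈⁅j⁆ with refl ← x∈⁅y⁆⇒x≡y j i∈⁅j⁆ = sⱼ≡xⱼ

  InM? : ∀ I x → U.Decidable (InM Γ I x)
  InM? I x s = (s ∈? Γ) ×-dec all? (λ i → (i ∈ₛ? I) →-dec (lookup s i ℤ.≟ x i))

  module _ {I : Subset k} {x : Fin k → ℤ} (y : Pt k) {j} (j∉I : j ∉ I) where
    private
      _≼_ : Rel (Pt k) 0ℓ
      _≼_ = LeOff (topAt y) I

      ≼-trans : Transitive _≼_
      ≼-trans a≼b b≼c i i∉I =
        IsTotalOrder.trans (TopAt-isTotalOrder (lookup y i)) (a≼b i i∉I) (b≼c i i∉I)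

      _≼?_ : Decidable _≼_
      a ≼? b = all? λ i → ¬? (i ∈ₛ? I) →-dec TopAt-dec (lookup y i) (lookup a i) (lookup b i)

      Attains? : U.Decidable (λ s → InM Γ I x s × lookup s j ≡ lookup y j)
      Attains? s = InM? I x s ×-dec (lookup s j ℤ.≟ lookup y j)

    maximal-attaining : (∃ λ s → InM Γ I x s × lookup s j ≡ lookup y j) →
                        ∃ λ m → IsMaxSec Γ I x (topAt y) m × lookup m j ≡ lookup y j
    maximal-attaining (s , s∈M , sⱼ)
      with maximal-∈ (λ {a b c} → ≼-trans {a} {b} {c}) _≼?_
                     (∈-filter⁺ Attains? (proj₁ s∈M) (s∈M , sⱼ))
    ... | m , m∈ , m-max with ∈-filter⁻ Attains? {xs = Γ} m∈
    ...   | _ , m∈M , mⱼ = m , (m∈M , maximal-in-section) , mⱼ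
      where
      maximal-in-section : ∀ w → InM Γ I x w → m ≼ w → AgreeOff I m w
      maximal-in-section w w∈M m≼w i i∉I =
        IsTotalOrder.antisym (TopAt-isTotalOrder (lookup y i)) (m≼w i i∉I) (w≼m i i∉I)
        where
        wⱼ : lookup w j ≡ lookup y j
        wⱼ = TopAt-maximal (subst (λ t → TopAt (lookup y j) t (lookup w j)) mⱼ (m≼w j j∉I))
        w≼m : w ≼ m
        w≼m = m-max (∈-filter⁺ Attains? (proj₁ w∈M) (w∈M , wⱼ)) m≼w

RealisedOver : ∀ {k} → FinSet k → Subset k → Pt k → Set
RealisedOver Γ I y = ∃ (InM Γ I (lookup y)) ×
  (∀ j → j ∉ I → ∃ λ s → InM Γ I (lookup y) s × lookup s j ≡ lookup y j)

module _ {k} {Γ : FinSet k} (degenerate : MaximalSectionsDegenerate Γ) where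

  realisedOver-step : ∀ {I y} → ProperSubset I → RealisedOver Γ I y →
                      ∃ λ j → j ∉ I × RealisedOver Γ (I ∪ ⁅ j ⁆) y
  realisedOver-step {I} {y} proper ((s , s∈Γ , s∈M) , attained)
    with degenerate I proper (lookup y) (λ i i∈I → s , s∈Γ , s∈M i i∈I) (topAt y)
  ... | j , j∉I , constant with maximal-attaining Γ y j∉I (attained j j∉I)
  ...   | m₀ , m₀-max , m₀ⱼ = j , j∉I , (m₀ , InM-∪-⁅⁆ Γ (proj₁ m₀-max) m₀ⱼ) , attained′
    where
    attained′ : ∀ j′ → j′ ∉ I ∪ ⁅ j ⁆ →
                ∃ λ m → InM Γ (I ∪ ⁅ j ⁆) (lookup y) m × lookup m j′ ≡ lookup y j′
    attained′ j′ j′∉I∪j =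
      let j′∉I = j′∉I∪j ∘ p⊆p∪q ⁅ j ⁆
          m , m-max , mⱼ′ = maximal-attaining Γ y j′∉I (attained j′ j′∉I)
      in m , InM-∪-⁅⁆ Γ (proj₁ m-max) (trans (constant m m₀ m-max m₀-max) m₀ⱼ) , mⱼ′

  realisedOver⇒∈ : ∀ {I y} → Acc _⊃_ I → RealisedOver Γ I y → y ∈ Γ
  realisedOver⇒∈ {I} {y} (acc rs) realised@((s , s∈Γ , s∈M) , _) with all? (_∈ₛ? I)
  ... | yes full = subst (_∈ Γ) (Pointwise-≡⇒≡ (ext λ i → s∈M i (full i))) s∈Γ
  ... | no ¬full with realisedOver-step {y = y} (¬∀⟶∃¬ k _ (_∈ₛ? I) ¬full) realised
  ...   | j , j∉I , realised′ = realisedOver⇒∈ {y = y} (rs (∪⁅⁆-⊃ j∉I)) realised′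

  degenerate⇒product : 1 ≤ k → IsProduct Γ
  degenerate⇒product (s≤s _) v = (λ v∈Γ i → v , v∈Γ , refl) ,
    λ v∈∏ → realisedOver⇒∈ (⊃-wellFounded ⊥) (realised-⊥ v∈∏)
    where
    realised-⊥ : (∀ i → InProj Γ i (lookup v i)) → RealisedOver Γ ⊥ v
    realised-⊥ v∈∏ = map₂ proj₁ (attained zero ∉⊥) , attained
      where
      attained : ∀ j → j ∉ ⊥ → ∃ λ s → InM Γ ⊥ (lookup v) s × lookup s j ≡ lookup v j
      attained j _ with v∈∏ j
      ... | s , s∈Γ , sⱼ = s , (s∈Γ , λ i i∈⊥ → contradiction i∈⊥ ∉⊥) , sⱼ

lemma2 : (k : ℕ) → 1 ≤ k → (Γ : FinSet k) →
    (((I : Subset k) → ProperSubset I → (x : Fin k → ℤ) → InProdP Γ I x →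
        (σ : ProductOrdering k) → HZeroMaxSec Γ I x σ) → IsProduct Γ)
    × (IsProduct Γ → ((I : Subset k) → ProperSubset I → (x : Fin k → ℤ) → InProdP Γ I x →
        (σ : ProductOrdering k) → HZeroMaxSec Γ I x σ))
lemma2 k 1≤k Γ = (λ degenerate → degenerate⇒product degenerate 1≤k) , product⇒degenerate
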